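{- Fix integers $t \ge 1$ and, for each $i = 1, \ldots, t$, an integer $d(i) \ge 1$ and integers $1 < a_{2,i} < a_{3,i} < \cdots < a_{d(i),i}$. For each $k \ge \max_i d(i)$, let $f_k(x_1, \ldots, x_k)$ be the rotation symmetric Boolean function in $k$ variables generated by the sum of the $t$ monomials $x_1 x_{a_{2,i}} \cdots x_{a_{d(i),i}}$, $1 \le i \le t$, and let $w_k = wt(f_k)$. Then the sequence $\{w_k : k = \max_i d(i), \max_i d(i)+1, \ldots\}$ satisfies a homogeneous linear recursion with integer coefficients: there exist an integer $L \ge 1$ and integers $c_1, \ldots, c_L$ such that $w_k = c_1 w_{k-1} + c_2 w_{k-2} + \cdots + c_L w_{k-L}$ for all $k \ge \max_i d(i) + L$.
   Context: A Boolean function in $k$ variables is a map $GF(2)^k \to GF(2)$; it is identified with its algebraic normal form (a polynomial over $GF(2)$ in $x_1,\dots,x_k$ with $x_j^2 = x_j$). The Hamming weight $wt(f)$ is the number of $x \in GF(2)^k$ with $f(x) = 1$. Let $\rho(x_1, \ldots, x_k) = (x_2, \ldots, x_k, x_1)$; $f$ is rotation symmetric if $f(\rho(x)) = f(x)$ for all $x$. The rotation symmetric function in $k$ variables generated by a monomial $x_1 x_{a_2} \cdots x_{a_d}$ is the sum (mod 2) of the distinct monomials in its orbit under the cyclic shifts of indices $x_j \mapsto x_{j+1}$, indices taken mod $k$ in $\{1, \ldots, k\}$; the function generated by a sum of monomials is the sum (mod 2) of the functions generated by each monomial. -}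

module Defs where

open import Data.Bool using (Bool; true; false; not; _∨_; _∧_; _xor_; if_then_else_)
open import Data.Bool.Properties using () renaming (_≟_ to _≟𝔹_)
open import Data.Nat using (ℕ; zero; suc; _+_; _∸_; _≡ᵇ_; _%_; _⊔_)
open import Data.Fin using (Fin; toℕ)
open import Data.List using (List; []; _∷_; map; foldr; upTo; deduplicate; length; concatMap)
open import Data.Vec using (Vec; []; _∷_; tabulate; zipWith; toList)
import Data.Vec.Properties as VecP
open import Data.Integer using (ℤ; +_) renaming (_+_ to _+ℤ_; _*_ to _*ℤ_)

-- Boolean vectors x ∈ GF(2)^k, with x_j (1-based) stored at position j-1.

points : (k : ℕ) → List (Vec Bool k)
points zero = [] ∷ []
points (suc k) = concatMap (λ v → (false ∷ v) ∷ (true ∷ v) ∷ []) (points k)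

-- A monomial in k variables, as its set of variables (a subset of positions).
-- monomial k idx = x_{a} * ... for a ∈ idx (1-based indices), indices
-- reduced mod k into {1,…,k}; repeated variables collapse since x_j^2 = x_j.
monomial : (k : ℕ) → List ℕ → Vec Bool k
monomial zero _ = []
monomial (suc n) idx =
  tabulate (λ p → foldr (λ a b → (toℕ p ≡ᵇ ((a ∸ 1) % suc n)) ∨ b) false idx)

shiftIdx : ℕ → List ℕ → List ℕ
shiftIdx s = map (λ a → a + s)

orbit : (k : ℕ) → List ℕ → List (Vec Bool k)
orbit k idx = deduplicate (VecP.≡-dec _≟𝔹_) (map (λ s → monomial k (shiftIdx s idx)) (upTo k))

evalMono : {k : ℕ} → Vec Bool k → Vec Bool k → Bool
evalMono m x = foldr _∧_ true (toList (zipWith (λ s b → not s ∨ b) m x))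

rotSym1 : (k : ℕ) → List ℕ → Vec Bool k → Bool
rotSym1 k idx x = foldr (λ m b → evalMono m x xor b) false (orbit k idx)

-- A generator is the list [a₂,…,a_d]; it stands for the monomial x₁ x_{a₂} ⋯ x_{a_d}.
-- f_k = sum over generators of the rotation symmetric functions they generate.
rotSym : (k : ℕ) → List (List ℕ) → Vec Bool k → Bool
rotSym k gens x = foldr (λ as b → rotSym1 k (1 ∷ as) x xor b) false gens

weight : (k : ℕ) → (Vec Bool k → Bool) → ℕ
weight k f = foldr (λ x n → (if f x then 1 else 0) + n) 0 (points k)

-- max_i d(i), where d(i) = 1 + length [a₂,…,a_d]
maxDeg : List (List ℕ) → ℕ
maxDeg = foldr (λ as m → suc (length as) ⊔ m) 0

w : List (List ℕ) → ℕ → ℤ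
w gens k = + weight k (rotSym k gens)

Σ< : ℕ → (ℕ → ℤ) → ℤ
Σ< zero g = + 0
Σ< (suc L) g = Σ< L g +ℤ g L

module Submission where

-- Fix a memory m ≥ every index a − 1 of the generating monomials.  Read a
-- string y ∈ GF(2)^k from its last bit to its first, remembering the m most
-- recently read bits (a window) and the parity of g(b ∷ window) over the bits b
-- read, where g(ω) = Σ_i Π_{a ∈ {1, a₂ᵢ, …}} ω(a − 1).  Started from the window
-- of y's own first m bits, the reader visits every cyclic shift of every
-- generating monomial once, and for k ≥ 2m + 2 these shifts are distinct, so
-- the final parity is f_k(y).  Hence w_k counts the strings leading from a
-- state (0, u) to (1, u), summed over u.  These counts solve a linear system
-- v = c + X·T v over ℤ[[X]] with an integer transition matrix T; eliminating
-- the unknowns one by one yields a polynomial D with D(0) = 1 and D·Σ_k w_k Xᵏ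
-- a polynomial up to finitely many terms, i.e. a linear recurrence for w_k.

open import Algebra.Bundles using (CommutativeMonoid)
open import Data.Bool using (Bool)
open import Data.Nat using (ℕ; suc; _≤_)
open import Data.List using (List; _∷_)
open import Data.List.Relation.Unary.All using (All)
open import Data.Vec using (Vec)
open import Data.Product using (_×_)
open import Defs using (points)

-- Sums of integers, parities (xor) and conjunctions in this development are
-- all instances, so each bookkeeping fact is proved once.
module BigOp {c ℓ} (M : CommutativeMonoid c ℓ) where

  open import Data.List using (List; []; _∷_; _++_; foldr; map; concatMap)
  open import Data.List.Relation.Unary.All using (All; []; _∷_)
  open CommutativeMonoid M
  open import Algebra.Properties.CommutativeSemigroup commutativeSemigroup using (interchange)
  open import Relation.Binary.Reasoning.Setoid setoid

  ⨁ : {A : Set} → List A → (A → Carrier) → Carrier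
  ⨁ l f = foldr (λ a s → f a ∙ s) ε l

  ⨁-congᴬ : {A : Set} (l : List A) {f g : A → Carrier} →
    All (λ a → f a ≈ g a) l → ⨁ l f ≈ ⨁ l g
  ⨁-congᴬ [] [] = refl
  ⨁-congᴬ (a ∷ l) (p ∷ ps) = ∙-cong p (⨁-congᴬ l ps)

  ⨁-cong : {A : Set} (l : List A) {f g : A → Carrier} →
    (∀ a → f a ≈ g a) → ⨁ l f ≈ ⨁ l g
  ⨁-cong [] p = refl
  ⨁-cong (a ∷ l) p = ∙-cong (p a) (⨁-cong l p)

  ⨁-map : {A B : Set} (g : A → B) (l : List A) (f : B → Carrier) →
    ⨁ (map g l) f ≈ ⨁ l (λ a → f (g a))
  ⨁-map g [] f = refl
  ⨁-map g (a ∷ l) f = ∙-congˡ (⨁-map g l f)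

  ⨁-++ : {A : Set} (l₁ l₂ : List A) (f : A → Carrier) →
    ⨁ (l₁ ++ l₂) f ≈ ⨁ l₁ f ∙ ⨁ l₂ f
  ⨁-++ [] l₂ f = sym (identityˡ _)
  ⨁-++ (a ∷ l₁) l₂ f = trans (∙-congˡ (⨁-++ l₁ l₂ f)) (sym (assoc _ _ _))

  ⨁-concatMap : {A B : Set} (g : A → List B) (l : List A) (f : B → Carrier) →
    ⨁ (concatMap g l) f ≈ ⨁ l (λ a → ⨁ (g a) f)
  ⨁-concatMap g [] f = refl
  ⨁-concatMap g (a ∷ l) f = trans (⨁-++ (g a) (concatMap g l) f) (∙-congˡ (⨁-concatMap g l f))

  ⨁-ε : {A : Set} (l : List A) → ⨁ l (λ _ → ε) ≈ ε
  ⨁-ε [] = refl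
  ⨁-ε (a ∷ l) = trans (identityˡ _) (⨁-ε l)

  ⨁-∙ : {A : Set} (l : List A) (f g : A → Carrier) →
    ⨁ l (λ a → f a ∙ g a) ≈ ⨁ l f ∙ ⨁ l g
  ⨁-∙ [] f g = sym (identityˡ ε)
  ⨁-∙ (a ∷ l) f g = trans (∙-congˡ (⨁-∙ l f g)) (interchange (f a) (g a) _ _)

  ⨁-swap : {A B : Set} (l₁ : List A) (l₂ : List B) (h : A → B → Carrier) →
    ⨁ l₁ (λ a → ⨁ l₂ (h a)) ≈ ⨁ l₂ (λ b → ⨁ l₁ (λ a → h a b))
  ⨁-swap [] l₂ h = sym (⨁-ε l₂)
  ⨁-swap (a ∷ l₁) l₂ h = trans (∙-congˡ (⨁-swap l₁ l₂ h)) (sym (⨁-∙ l₂ (h a) _))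

module _ {c₁ ℓ₁ c₂ ℓ₂} (M : CommutativeMonoid c₁ ℓ₁) (N : CommutativeMonoid c₂ ℓ₂) where

  open import Data.List using ([])
  private
    module M = CommutativeMonoid M
    module N = CommutativeMonoid N
    module ⨁M = BigOp M
    module ⨁N = BigOp N

  ⨁-hom : (h : M.Carrier → N.Carrier) → h M.ε N.≈ N.ε →
    (∀ a b → h (a M.∙ b) N.≈ h a N.∙ h b) →
    {A : Set} (l : List A) (f : A → M.Carrier) → h (⨁M.⨁ l f) N.≈ ⨁N.⨁ l (λ a → h (f a))
  ⨁-hom h h-ε h-∙ [] f = h-ε
  ⨁-hom h h-ε h-∙ (a ∷ l) f = N.trans (h-∙ _ _) (N.∙-congˡ (⨁-hom h h-ε h-∙ l f))

module Folds where
  open import Data.Bool using (Bool; if_then_else_)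
  open import Data.Bool.Properties using (xor-∧-commutativeRing; ∧-commutativeMonoid)
  open import Data.Integer using (ℤ; +_)
  import Data.Integer.Properties as ℤ
  open import Algebra.Bundles using (CommutativeRing)

  module Sumℤ = BigOp ℤ.+-0-commutativeMonoid renaming (⨁ to Σℤ)
  module Parity = BigOp (CommutativeRing.+-commutativeMonoid xor-∧-commutativeRing) renaming (⨁ to parity)
  module Every = BigOp ∧-commutativeMonoid renaming (⨁ to every)
  open Sumℤ public using (Σℤ)
  open Parity public using (parity)
  open Every public using (every)

  𝕀 : Bool → ℤ
  𝕀 b = + (if b then 1 else 0)

-- The ring ℤ[[X]] of formal power series with integer coefficients.
module PowerSeries where

  open import Level using (0ℓ)
  open import Data.Nat using (ℕ; zero; suc)
  open import Data.Integer using (ℤ; +_; _+_; _*_; -_)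
  import Data.Integer.Properties as ℤ
  open import Data.Integer.Tactic.RingSolver using (solve-∀)
  open import Data.Product using (_,_)
  open import Relation.Binary.PropositionalEquality
  open import Relation.Nullary using (yes; no)
  open import Data.Maybe using (Maybe; just; nothing)
  open import Algebra.Bundles using (CommutativeRing)
  import Algebra.Solver.Ring.AlmostCommutativeRing as ACR

  Series : Set
  Series = ℕ → ℤ

  infix  4 _≋_
  infixl 6 _⊕_
  infixl 7 _⊛_ _·_

  -- Coefficientwise equality, wrapped in a record so that both series can be
  -- read off from the type (the ring solver relies on this).
  record _≋_ (f g : Series) : Set where
    constructor coeffwise
    field coeff : f ≗ g
  open _≋_ public

  _⊕_ : Series → Series → Series
  (f ⊕ g) k = f k + g k

  ⊝_ : Series → Series
  (⊝ f) k = - f k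

  _·_ : ℤ → Series → Series
  (a · f) k = a * f k

  𝟘 𝟙 X : Series
  𝟘 _ = + 0
  𝟙 zero = + 1
  𝟙 (suc _) = + 0
  X (suc zero) = + 1
  X _ = + 0

  tailS : Series → Series
  tailS f k = f (suc k)

  -- Cauchy product, by recursion on the first factor: f = f 0 + X · tailS f.
  _⊛_ : Series → Series → Series
  (f ⊛ g) zero = f 0 * g 0
  (f ⊛ g) (suc k) = f 0 * g (suc k) + (tailS f ⊛ g) k

  ⊛-cong : ∀ {f f′ g g′} → f ≗ f′ → g ≗ g′ → f ⊛ g ≗ f′ ⊛ g′
  ⊛-cong p q zero = cong₂ _*_ (p 0) (q 0)
  ⊛-cong p q (suc k) = cong₂ _+_ (cong₂ _*_ (p 0) (q (suc k))) (⊛-cong (λ j → p (suc j)) q k)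

  ⊛-distribˡ : ∀ f g h → f ⊛ (g ⊕ h) ≗ f ⊛ g ⊕ f ⊛ h
  ⊛-distribˡ f g h zero = ℤ.*-distribˡ-+ (f 0) (g 0) (h 0)
  ⊛-distribˡ f g h (suc k) rewrite ⊛-distribˡ (tailS f) g h k =
    distribute (f 0) (g (suc k)) (h (suc k)) _ _
    where
    distribute : ∀ a b c d e → a * (b + c) + (d + e) ≡ (a * b + d) + (a * c + e)
    distribute = solve-∀

  ⊛-distribʳ : ∀ f g h → (f ⊕ g) ⊛ h ≗ f ⊛ h ⊕ g ⊛ h
  ⊛-distribʳ f g h zero = ℤ.*-distribʳ-+ (h 0) (f 0) (g 0)
  ⊛-distribʳ f g h (suc k) rewrite ⊛-distribʳ (tailS f) (tailS g) h k =
    distribute (f 0) (g 0) (h (suc k)) _ _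
    where
    distribute : ∀ a b c d e → (a + b) * c + (d + e) ≡ (a * c + d) + (b * c + e)
    distribute = solve-∀

  ⊛-·ˡ : ∀ a f g → (a · f) ⊛ g ≗ a · (f ⊛ g)
  ⊛-·ˡ a f g zero = ℤ.*-assoc a (f 0) (g 0)
  ⊛-·ˡ a f g (suc k) rewrite ⊛-·ˡ a (tailS f) g k = factor a (f 0) (g (suc k)) _
    where
    factor : ∀ a b c d → a * b * c + a * d ≡ a * (b * c + d)
    factor = solve-∀

  ⊛-zeroˡ : ∀ g → 𝟘 ⊛ g ≗ 𝟘
  ⊛-zeroˡ g zero = refl
  ⊛-zeroˡ g (suc k) rewrite ⊛-zeroˡ g k = refl

  ⊛-identityˡ : ∀ g → 𝟙 ⊛ g ≗ g
  ⊛-identityˡ g zero = ℤ.*-identityˡ (g 0)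
  ⊛-identityˡ g (suc k) rewrite ⊛-zeroˡ g k = trans (ℤ.+-identityʳ _) (ℤ.*-identityˡ (g (suc k)))

  -- Commutativity needs two unfoldings: both sides share the term (tailS f ⊛ tailS g).
  ⊛-comm : ∀ f g → f ⊛ g ≗ g ⊛ f
  ⊛-comm f g zero = ℤ.*-comm (f 0) (g 0)
  ⊛-comm f g (suc zero) =
    trans (cong₂ _+_ (ℤ.*-comm (f 0) (g 1)) (ℤ.*-comm (f 1) (g 0))) (ℤ.+-comm (g 1 * f 0) (g 0 * f 1))
  ⊛-comm f g (suc (suc k)) = begin
      f 0 * g (2+ k) + (tailS f ⊛ g) (suc k)
    ≡⟨ cong (_+_ (f 0 * g (2+ k))) (⊛-comm (tailS f) g (suc k)) ⟩
      f 0 * g (2+ k) + (g 0 * f (2+ k) + (tailS g ⊛ tailS f) k)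
    ≡⟨ cong (λ z → f 0 * g (2+ k) + (g 0 * f (2+ k) + z)) (⊛-comm (tailS g) (tailS f) k) ⟩
      f 0 * g (2+ k) + (g 0 * f (2+ k) + (tailS f ⊛ tailS g) k)
    ≡⟨ exchange (f 0 * g (2+ k)) (g 0 * f (2+ k)) _ ⟩
      g 0 * f (2+ k) + (f 0 * g (2+ k) + (tailS f ⊛ tailS g) k)
    ≡⟨ cong (_+_ (g 0 * f (2+ k))) (⊛-comm f (tailS g) (suc k)) ⟩
      g 0 * f (2+ k) + (tailS g ⊛ f) (suc k)
    ∎
    where
    open ≡-Reasoning
    2+ : ℕ → ℕ
    2+ n = suc (suc n)
    exchange : ∀ a b c → a + (b + c) ≡ b + (a + c)
    exchange = solve-∀

  ⊛-assoc : ∀ f g h → (f ⊛ g) ⊛ h ≗ f ⊛ (g ⊛ h)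
  ⊛-assoc f g h zero = ℤ.*-assoc (f 0) (g 0) (h 0)
  ⊛-assoc f g h (suc k) = begin
      f 0 * g 0 * h (suc k) + (tailS (f ⊛ g) ⊛ h) k
    ≡⟨ cong (_+_ (f 0 * g 0 * h (suc k))) (⊛-distribʳ (f 0 · tailS g) (tailS f ⊛ g) h k) ⟩
      f 0 * g 0 * h (suc k) + (((f 0 · tailS g) ⊛ h) k + ((tailS f ⊛ g) ⊛ h) k)
    ≡⟨ cong₂ (λ a b → f 0 * g 0 * h (suc k) + (a + b)) (⊛-·ˡ (f 0) (tailS g) h k) (⊛-assoc (tailS f) g h k) ⟩
      f 0 * g 0 * h (suc k) + (f 0 * (tailS g ⊛ h) k + (tailS f ⊛ (g ⊛ h)) k)
    ≡⟨ factor (f 0) (g 0) (h (suc k)) _ _ ⟩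
      f 0 * (g 0 * h (suc k) + (tailS g ⊛ h) k) + (tailS f ⊛ (g ⊛ h)) k
    ∎
    where
    open ≡-Reasoning
    factor : ∀ a b c d e → a * b * c + (a * d + e) ≡ a * (b * c + d) + e
    factor = solve-∀

  X-⊛ : ∀ f k → (X ⊛ f) (suc k) ≡ f k
  X-⊛ f k = trans (ℤ.+-identityˡ _) (trans (⊛-cong tailX≗𝟙 (λ _ → refl) k) (⊛-identityˡ f k))
    where
    tailX≗𝟙 : tailS X ≗ 𝟙
    tailX≗𝟙 zero = refl
    tailX≗𝟙 (suc _) = refl

  X-⊛-zero : ∀ f → (X ⊛ f) 0 ≡ + 0
  X-⊛-zero f = ℤ.*-zeroˡ (f 0)

  -- ℤ[[X]] as a commutative ring: this makes the ring solver and the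
  -- library's finite sums over Fin available for series.
  ring : CommutativeRing 0ℓ 0ℓ
  ring = record
    { Carrier = Series ; _≈_ = _≋_ ; _+_ = _⊕_ ; _*_ = _⊛_ ; -_ = ⊝_ ; 0# = 𝟘 ; 1# = 𝟙
    ; isCommutativeRing = record
      { isRing = record
        { +-isAbelianGroup = record
          { isGroup = record
            { isMonoid = record
              { isSemigroup = record
                { isMagma = record
                  { isEquivalence = record
                    { refl = coeffwise (λ _ → refl)
                    ; sym = λ p → coeffwise (λ k → sym (coeff p k))
                    ; trans = λ p q → coeffwise (λ k → trans (coeff p k) (coeff q k)) }
                  ; ∙-cong = λ p q → coeffwise (λ k → cong₂ _+_ (coeff p k) (coeff q k)) }
                ; assoc = λ f g h → coeffwise (λ k → ℤ.+-assoc (f k) (g k) (h k)) }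
              ; identity = (λ f → coeffwise (λ k → ℤ.+-identityˡ (f k)))
                         , (λ f → coeffwise (λ k → ℤ.+-identityʳ (f k))) }
            ; inverse = (λ f → coeffwise (λ k → ℤ.+-inverseˡ (f k)))
                      , (λ f → coeffwise (λ k → ℤ.+-inverseʳ (f k)))
            ; ⁻¹-cong = λ p → coeffwise (λ k → cong -_ (coeff p k)) }
          ; comm = λ f g → coeffwise (λ k → ℤ.+-comm (f k) (g k)) }
        ; *-cong = λ p q → coeffwise (⊛-cong (coeff p) (coeff q))
        ; *-assoc = λ f g h → coeffwise (⊛-assoc f g h)
        ; *-identity = (λ f → coeffwise (⊛-identityˡ f))
                     , (λ f → coeffwise (λ k → trans (⊛-comm f 𝟙 k) (⊛-identityˡ f k)))
        ; distrib = (λ f g h → coeffwise (⊛-distribˡ f g h))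
                  , (λ h f g → coeffwise (⊛-distribʳ f g h)) }
      ; *-comm = λ f g → coeffwise (⊛-comm f g) } }

  ⨁-coeff : {A : Set} (l : List A) (f : A → Series) (k : ℕ) →
    BigOp.⨁ (CommutativeRing.+-commutativeMonoid ring) l f k ≡ Folds.Σℤ l (λ a → f a k)
  ⨁-coeff l f k = ⨁-hom (CommutativeRing.+-commutativeMonoid ring) ℤ.+-0-commutativeMonoid
                        (λ h → h k) refl (λ _ _ → refl) l f

  -- Congruences with the fixed operand explicit: the operands of ⊕ and ⊛
  -- cannot be inferred from a coefficientwise equation.
  ⊕-congˡ : ∀ a {f g} → f ≋ g → a ⊕ f ≋ a ⊕ g
  ⊕-congˡ a p = coeffwise (λ k → cong (_+_ (a k)) (coeff p k))

  ⊕-congʳ : ∀ b {f g} → f ≋ g → f ⊕ b ≋ g ⊕ b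
  ⊕-congʳ b p = coeffwise (λ k → cong (_+ b k) (coeff p k))

  ⊛-congˡ : ∀ a {f g} → f ≋ g → a ⊛ f ≋ a ⊛ g
  ⊛-congˡ a p = coeffwise (⊛-cong (λ _ → refl) (coeff p))

  ⟨_⟩ : ℤ → Series
  ⟨ a ⟩ = a · 𝟙

  ⟨⟩-⊛ : ∀ a f → ⟨ a ⟩ ⊛ f ≗ a · f
  ⟨⟩-⊛ a f k = trans (⊛-·ˡ a 𝟙 f k) (cong (a *_) (⊛-identityˡ f k))

  -- The ring solver for ℤ[[X]], with integer constants embedded by ⟨_⟩.
  private
    constants : CommutativeRing.rawRing ℤ.+-*-commutativeRing
      ACR.-Raw-AlmostCommutative⟶ ACR.fromCommutativeRing ring
    constants = record
      { ⟦_⟧ = ⟨_⟩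
      ; +-homo = λ a b → coeffwise (λ k → ℤ.*-distribʳ-+ (𝟙 k) a b)
      ; *-homo = λ a b → coeffwise (λ k → trans (ℤ.*-assoc a b (𝟙 k)) (sym (⟨⟩-⊛ a ⟨ b ⟩ k)))
      ; -‿homo = λ a → coeffwise (λ k → sym (ℤ.neg-distribˡ-* a (𝟙 k)))
      ; 0-homo = coeffwise (λ k → ℤ.*-zeroˡ (𝟙 k))
      ; 1-homo = coeffwise (λ k → ℤ.*-identityˡ (𝟙 k))
      }

    constants-equal? : ∀ a b → Maybe (⟨ a ⟩ ≋ ⟨ b ⟩)
    constants-equal? a b with a ℤ.≟ b
    ... | yes refl = just (coeffwise (λ _ → refl))
    ... | no _ = nothing

  open import Algebra.Solver.Ring _ (ACR.fromCommutativeRing ring) constants constants-equal? public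
    using (solve; _:=_; _:+_; _:*_; :-_)

-- Polynomials inside ℤ[[X]]: series whose coefficients vanish from some degree on.
module Polynomials where

  open PowerSeries
  open import Data.Nat using (ℕ; zero; suc; _≤_; _+_; z≤n; s≤s)
  open import Data.Nat.Properties using (≤-trans; m≤m+n; m≤n+m)
  open import Data.Integer using (+_; -_) renaming (_+_ to _+ℤ_; _*_ to _*ℤ_)
  import Data.Integer.Properties as ℤ
  open import Data.Fin using (Fin; zero; suc)
  open import Data.List using (List; []; _∷_)
  open import Data.Product using (Σ; _,_)
  open import Function using (_∘_)
  open import Relation.Binary.PropositionalEquality
  open import Algebra.Bundles using (CommutativeRing)
  open import Algebra.Properties.Semiring.Sum (CommutativeRing.semiring ring) using (sum)
  open BigOp (CommutativeRing.+-commutativeMonoid ring) using (⨁)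

  IsPoly : Series → Set
  IsPoly f = Σ ℕ λ d → ∀ k → d ≤ k → f k ≡ + 0

  IsPoly-resp : ∀ {f g} → f ≋ g → IsPoly f → IsPoly g
  IsPoly-resp f≋g (d , f-vanishes) = d , λ k d≤k → trans (sym (coeff f≋g k)) (f-vanishes k d≤k)

  IsPoly-𝟘 : IsPoly 𝟘
  IsPoly-𝟘 = 0 , λ _ _ → refl

  IsPoly-𝟙 : IsPoly 𝟙
  IsPoly-𝟙 = 1 , λ { (suc _) _ → refl }

  IsPoly-X : IsPoly X
  IsPoly-X = 2 , λ { (suc zero) (s≤s ()) ; (suc (suc _)) _ → refl }

  IsPoly-⊕ : ∀ {f g} → IsPoly f → IsPoly g → IsPoly (f ⊕ g)
  IsPoly-⊕ (d , f0) (e , g0) = d + e , λ k le →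
    cong₂ _+ℤ_ (f0 k (≤-trans (m≤m+n d e) le)) (g0 k (≤-trans (m≤n+m e d) le))

  IsPoly-⊝ : ∀ {f} → IsPoly f → IsPoly (⊝ f)
  IsPoly-⊝ (d , f0) = d , λ k le → cong -_ (f0 k le)

  IsPoly-⟨⟩ : ∀ a → IsPoly ⟨ a ⟩
  IsPoly-⟨⟩ a = 1 , λ { (suc _) _ → ℤ.*-zeroʳ a }

  ⊛-vanishes : ∀ d e f g → (∀ k → d ≤ k → f k ≡ + 0) → (∀ k → e ≤ k → g k ≡ + 0) →
    ∀ k → d + e ≤ k → (f ⊛ g) k ≡ + 0
  ⊛-vanishes zero e f g f0 g0 k le =
    trans (⊛-cong {g = g} (λ j → f0 j z≤n) (λ _ → refl) k) (⊛-zeroˡ g k)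
  ⊛-vanishes (suc d) e f g f0 g0 (suc k) (s≤s le) =
    cong₂ _+ℤ_ (trans (cong (f 0 *ℤ_) (g0 (suc k) (≤-trans (m≤n+m e (suc d)) (s≤s le)))) (ℤ.*-zeroʳ (f 0)))
               (⊛-vanishes d e (tailS f) g (λ j le′ → f0 (suc j) (s≤s le′)) g0 k le)

  IsPoly-⊛ : ∀ {f g} → IsPoly f → IsPoly g → IsPoly (f ⊛ g)
  IsPoly-⊛ {f} {g} (d , f0) (e , g0) = d + e , ⊛-vanishes d e f g f0 g0

  IsPoly-sum : ∀ {n} (f : Fin n → Series) → (∀ i → IsPoly (f i)) → IsPoly (sum f)
  IsPoly-sum {zero} f p = IsPoly-𝟘
  IsPoly-sum {suc n} f p = IsPoly-⊕ (p zero) (IsPoly-sum (f ∘ suc) (p ∘ suc))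

  IsPoly-⨁ : {A : Set} (l : List A) (f : A → Series) → (∀ a → IsPoly (f a)) → IsPoly (⨁ l f)
  IsPoly-⨁ [] f p = IsPoly-𝟘
  IsPoly-⨁ (a ∷ l) f p = IsPoly-⊕ (p a) (IsPoly-⨁ l f p)

-- Eliminating the unknowns one at a time (Cramer's rule in disguise) gives a
-- polynomial D with D(0) = 1 such that each D·v_x is a polynomial
-- combination of the right-hand sides c_y.
module LinearSystems {S : Set} where

  open PowerSeries
  open Polynomials
  open import Data.Nat using (suc)
  open import Data.Integer using (ℤ; +_)
  open import Data.Fin using (Fin; zero; suc)
  open import Data.List using (List; []; _∷_; length; lookup)
  open import Relation.Binary.PropositionalEquality using (_≡_; refl)
  open import Algebra.Bundles using (CommutativeRing)
  open CommutativeRing ring using (setoid; +-cong; *-assoc; zeroʳ; +-identityʳ)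
    renaming (refl to ≋-refl; sym to ≋-sym; trans to ≋-trans)
  open import Algebra.Properties.Semiring.Sum (CommutativeRing.semiring ring)
    using (sum; ∑-distrib-+; *-distribˡ-sum; *-distribʳ-sum; sum-cong-≋)
  open BigOp (CommutativeRing.+-commutativeMonoid ring) using (⨁)
  open import Relation.Binary.Reasoning.Setoid setoid

  System : List S → (S → S → ℤ) → (S → Series) → (S → Series) → Set
  System ℓ M c v = ∀ x → v x ≋ c x ⊕ X ⊛ ⨁ ℓ (λ y → ⟨ M x y ⟩ ⊛ v y)

  record Elimination (ℓ : List S) (M : S → S → ℤ) : Set where
    field
      D : Series
      D-poly : IsPoly D
      D-const : D 0 ≡ + 1
      P : S → Fin (length ℓ) → Series
      P-poly : ∀ x i → IsPoly (P x i)
      eliminates : ∀ c v → System ℓ M c v →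
        ∀ x → D ⊛ v x ≋ D ⊛ c x ⊕ sum (λ i → P x i ⊛ c (lookup ℓ i))

  eliminate-[] : ∀ M → Elimination [] M
  eliminate-[] M = record
    { D = 𝟙 ; D-poly = IsPoly-𝟙 ; D-const = refl ; P = λ _ () ; P-poly = λ _ ()
    ; eliminates = λ c v sys x → ≋-trans (⊛-congˡ 𝟙 (≋-trans (sys x) (≋-trans (⊕-congˡ (c x) (zeroʳ X)) (+-identityʳ (c x)))))
                                          (≋-sym (+-identityʳ (𝟙 ⊛ c x))) }

  -- One elimination step: the unknown v_l is first treated as part of the
  -- right-hand side; the elimination for the remaining unknowns ℓ then
  -- yields an equation (D − X·G_l)·v_l = (polynomial combination of c),
  -- which is substituted back after multiplying through by E = D − X·G_l.
  module Step (M : S → S → ℤ) (l : S) (ℓ : List S) (IH : Elimination ℓ M) where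
    open Elimination IH

    comb : (S → Series) → S → Series
    comb c x = sum (λ i → P x i ⊛ c (lookup ℓ i))

    -- coefficient with which v_l re-enters the equation for v_x
    G : S → Series
    G x = ⟨ M x l ⟩ ⊛ D ⊕ comb (λ y → ⟨ M y l ⟩) x

    E : Series
    E = D ⊕ ⊝ (X ⊛ G l)

    -- the new denominator and coefficients, read off from eliminates′ below
    D′ : Series
    D′ = E ⊛ D

    P′ : S → Fin (suc (length ℓ)) → Series
    P′ x zero = X ⊛ G x ⊛ D
    P′ x (suc i) = E ⊛ P x i ⊕ X ⊛ G x ⊛ P l i

    comb-shift : ∀ c w x → comb (λ y → c y ⊕ X ⊛ (⟨ M y l ⟩ ⊛ w)) x ≋ comb c x ⊕ comb (λ y → ⟨ M y l ⟩) x ⊛ (X ⊛ w)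
    comb-shift c w x = begin
        sum (λ i → P x i ⊛ (c (lookup ℓ i) ⊕ X ⊛ (⟨ M (lookup ℓ i) l ⟩ ⊛ w)))
      ≈⟨ sum-cong-≋ (λ i → distribute (P x i) (c (lookup ℓ i)) X ⟨ M (lookup ℓ i) l ⟩ w) ⟩
        sum (λ i → P x i ⊛ c (lookup ℓ i) ⊕ (P x i ⊛ ⟨ M (lookup ℓ i) l ⟩) ⊛ (X ⊛ w))
      ≈⟨ ∑-distrib-+ (λ i → P x i ⊛ c (lookup ℓ i)) (λ i → (P x i ⊛ ⟨ M (lookup ℓ i) l ⟩) ⊛ (X ⊛ w)) ⟩
        comb c x ⊕ sum (λ i → (P x i ⊛ ⟨ M (lookup ℓ i) l ⟩) ⊛ (X ⊛ w))
      ≈⟨ ⊕-congˡ (comb c x) (≋-sym (*-distribʳ-sum (X ⊛ w) (λ i → P x i ⊛ ⟨ M (lookup ℓ i) l ⟩))) ⟩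
        comb c x ⊕ comb (λ y → ⟨ M y l ⟩) x ⊛ (X ⊛ w)
      ∎
      where
      distribute : ∀ p a b m w → p ⊛ (a ⊕ b ⊛ (m ⊛ w)) ≋ p ⊛ a ⊕ (p ⊛ m) ⊛ (b ⊛ w)
      distribute = solve 5 (λ p a b m w → p :* (a :+ b :* (m :* w)) := p :* a :+ (p :* m) :* (b :* w)) ≋-refl

    module _ (c v : S → Series) (sys : System (l ∷ ℓ) M c v) where

      absorbed : System ℓ M (λ x → c x ⊕ X ⊛ (⟨ M x l ⟩ ⊛ v l)) v
      absorbed x = ≋-trans (sys x) (split (c x) X (⟨ M x l ⟩ ⊛ v l) _)
        where
        split : ∀ a b c d → a ⊕ b ⊛ (c ⊕ d) ≋ (a ⊕ b ⊛ c) ⊕ b ⊛ d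
        split = solve 4 (λ a b c d → a :+ b :* (c :+ d) := (a :+ b :* c) :+ b :* d) ≋-refl

      eq-x : ∀ x → D ⊛ v x ≋ D ⊛ c x ⊕ comb c x ⊕ X ⊛ G x ⊛ v l
      eq-x x = begin
          D ⊛ v x
        ≈⟨ eliminates _ v absorbed x ⟩
          D ⊛ (c x ⊕ X ⊛ (⟨ M x l ⟩ ⊛ v l)) ⊕ comb (λ y → c y ⊕ X ⊛ (⟨ M y l ⟩ ⊛ v l)) x
        ≈⟨ ⊕-congˡ (D ⊛ (c x ⊕ X ⊛ (⟨ M x l ⟩ ⊛ v l))) (comb-shift c (v l) x) ⟩
          D ⊛ (c x ⊕ X ⊛ (⟨ M x l ⟩ ⊛ v l)) ⊕ (comb c x ⊕ comb (λ y → ⟨ M y l ⟩) x ⊛ (X ⊛ v l))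
        ≈⟨ regroup D (c x) X ⟨ M x l ⟩ (v l) (comb c x) _ ⟩
          D ⊛ c x ⊕ comb c x ⊕ X ⊛ G x ⊛ v l
        ∎
        where
        regroup : ∀ d a b m w s t → d ⊛ (a ⊕ b ⊛ (m ⊛ w)) ⊕ (s ⊕ t ⊛ (b ⊛ w)) ≋ d ⊛ a ⊕ s ⊕ b ⊛ (m ⊛ d ⊕ t) ⊛ w
        regroup = solve 7 (λ d a b m w s t → d :* (a :+ b :* (m :* w)) :+ (s :+ t :* (b :* w))
                                         := d :* a :+ s :+ b :* (m :* d :+ t) :* w) ≋-refl

      eq-l : E ⊛ v l ≋ D ⊛ c l ⊕ comb c l
      eq-l = begin
          (D ⊕ ⊝ (X ⊛ G l)) ⊛ v l
        ≈⟨ expand D (X ⊛ G l) (v l) ⟩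
          D ⊛ v l ⊕ ⊝ (X ⊛ G l ⊛ v l)
        ≈⟨ ⊕-congʳ (⊝ (X ⊛ G l ⊛ v l)) (eq-x l) ⟩
          D ⊛ c l ⊕ comb c l ⊕ X ⊛ G l ⊛ v l ⊕ ⊝ (X ⊛ G l ⊛ v l)
        ≈⟨ cancel (D ⊛ c l) (comb c l) _ ⟩
          D ⊛ c l ⊕ comb c l
        ∎
        where
        expand : ∀ d h w → (d ⊕ ⊝ h) ⊛ w ≋ d ⊛ w ⊕ ⊝ (h ⊛ w)
        expand = solve 3 (λ d h w → (d :+ :- h) :* w := d :* w :+ :- (h :* w)) ≋-refl
        cancel : ∀ a s t → a ⊕ s ⊕ t ⊕ ⊝ t ≋ a ⊕ s
        cancel = solve 3 (λ a s t → a :+ s :+ t :+ :- t := a :+ s) ≋-refl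

      comb′ : ∀ x → sum (λ i → P′ x i ⊛ c (lookup (l ∷ ℓ) i)) ≋ X ⊛ G x ⊛ D ⊛ c l ⊕ (E ⊛ comb c x ⊕ X ⊛ G x ⊛ comb c l)
      comb′ x = ⊕-congˡ (X ⊛ G x ⊛ D ⊛ c l) (begin
          sum (λ i → (E ⊛ P x i ⊕ X ⊛ G x ⊛ P l i) ⊛ c (lookup ℓ i))
        ≈⟨ sum-cong-≋ (λ i → distribute E (P x i) (X ⊛ G x) (P l i) (c (lookup ℓ i))) ⟩
          sum (λ i → E ⊛ (P x i ⊛ c (lookup ℓ i)) ⊕ X ⊛ G x ⊛ (P l i ⊛ c (lookup ℓ i)))
        ≈⟨ ∑-distrib-+ (λ i → E ⊛ (P x i ⊛ c (lookup ℓ i))) (λ i → X ⊛ G x ⊛ (P l i ⊛ c (lookup ℓ i))) ⟩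
          sum (λ i → E ⊛ (P x i ⊛ c (lookup ℓ i))) ⊕ sum (λ i → X ⊛ G x ⊛ (P l i ⊛ c (lookup ℓ i)))
        ≈⟨ +-cong (≋-sym (*-distribˡ-sum E (λ i → P x i ⊛ c (lookup ℓ i))))
                   (≋-sym (*-distribˡ-sum (X ⊛ G x) (λ i → P l i ⊛ c (lookup ℓ i)))) ⟩
          E ⊛ comb c x ⊕ X ⊛ G x ⊛ comb c l
        ∎)
        where
        distribute : ∀ e p h q a → (e ⊛ p ⊕ h ⊛ q) ⊛ a ≋ e ⊛ (p ⊛ a) ⊕ h ⊛ (q ⊛ a)
        distribute = solve 5 (λ e p h q a → (e :* p :+ h :* q) :* a := e :* (p :* a) :+ h :* (q :* a)) ≋-refl

      eliminates′ : ∀ x → D′ ⊛ v x ≋ D′ ⊛ c x ⊕ sum (λ i → P′ x i ⊛ c (lookup (l ∷ ℓ) i))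
      eliminates′ x = begin
          E ⊛ D ⊛ v x
        ≈⟨ *-assoc E D (v x) ⟩
          E ⊛ (D ⊛ v x)
        ≈⟨ ⊛-congˡ E (eq-x x) ⟩
          E ⊛ (D ⊛ c x ⊕ comb c x ⊕ X ⊛ G x ⊛ v l)
        ≈⟨ move-E E (D ⊛ c x ⊕ comb c x) (X ⊛ G x) (v l) ⟩
          E ⊛ (D ⊛ c x ⊕ comb c x) ⊕ X ⊛ G x ⊛ (E ⊛ v l)
        ≈⟨ ⊕-congˡ (E ⊛ (D ⊛ c x ⊕ comb c x)) (⊛-congˡ (X ⊛ G x) eq-l) ⟩
          E ⊛ (D ⊛ c x ⊕ comb c x) ⊕ X ⊛ G x ⊛ (D ⊛ c l ⊕ comb c l)
        ≈⟨ regroup E D (c x) (comb c x) (X ⊛ G x) (c l) (comb c l) ⟩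
          E ⊛ D ⊛ c x ⊕ (X ⊛ G x ⊛ D ⊛ c l ⊕ (E ⊛ comb c x ⊕ X ⊛ G x ⊛ comb c l))
        ≈⟨ ⊕-congˡ (E ⊛ D ⊛ c x) (≋-sym (comb′ x)) ⟩
          E ⊛ D ⊛ c x ⊕ sum (λ i → P′ x i ⊛ c (lookup (l ∷ ℓ) i))
        ∎
        where
        move-E : ∀ e a h w → e ⊛ (a ⊕ h ⊛ w) ≋ e ⊛ a ⊕ h ⊛ (e ⊛ w)
        move-E = solve 4 (λ e a h w → e :* (a :+ h :* w) := e :* a :+ h :* (e :* w)) ≋-refl
        regroup : ∀ e d a s h b t → e ⊛ (d ⊛ a ⊕ s) ⊕ h ⊛ (d ⊛ b ⊕ t) ≋ e ⊛ d ⊛ a ⊕ (h ⊛ d ⊛ b ⊕ (e ⊛ s ⊕ h ⊛ t))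
        regroup = solve 7 (λ e d a s h b t → e :* (d :* a :+ s) :+ h :* (d :* b :+ t)
                                          := e :* d :* a :+ (h :* d :* b :+ (e :* s :+ h :* t))) ≋-refl

    G-poly : ∀ x → IsPoly (G x)
    G-poly x = IsPoly-⊕ (IsPoly-⊛ (IsPoly-⟨⟩ (M x l)) D-poly)
                        (IsPoly-sum _ (λ i → IsPoly-⊛ (P-poly x i) (IsPoly-⟨⟩ (M (lookup ℓ i) l))))

    E-poly : IsPoly E
    E-poly = IsPoly-⊕ D-poly (IsPoly-⊝ (IsPoly-⊛ IsPoly-X (G-poly l)))

    P′-poly : ∀ x i → IsPoly (P′ x i)
    P′-poly x zero = IsPoly-⊛ (IsPoly-⊛ IsPoly-X (G-poly x)) D-poly
    P′-poly x (suc i) = IsPoly-⊕ (IsPoly-⊛ E-poly (P-poly x i)) (IsPoly-⊛ (IsPoly-⊛ IsPoly-X (G-poly x)) (P-poly l i))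

    -- E(0) = D(0) since X·G_l has no constant term
    D′-const : D′ 0 ≡ + 1
    D′-const rewrite D-const = refl

    result : Elimination (l ∷ ℓ) M
    result = record
      { D = D′ ; D-poly = IsPoly-⊛ E-poly D-poly ; D-const = D′-const
      ; P = P′ ; P-poly = P′-poly ; eliminates = eliminates′ }

  eliminate : ∀ ℓ M → Elimination ℓ M
  eliminate [] M = eliminate-[] M
  eliminate (l ∷ ℓ) M = Step.result M l ℓ (eliminate ℓ M)

-- A series W whose product with a polynomial D, D(0) = 1, is again a
-- polynomial satisfies the linear recurrence with coefficients −D(1), −D(2), …:
-- this is (D·W)_k = 0 for large k, rewritten.
module LinearRecurrences where

  open PowerSeries
  open Polynomials
  open import Defs using (Σ<)
  open import Data.Nat using (ℕ; zero; suc; _≤_; _<_; _∸_; _≤?_; z≤n; s≤s) renaming (_+_ to _+ℕ_)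
  open import Data.Nat.Properties
    using (≤-trans; ≤-refl; ≤-antisym; n≤1+n; ≰⇒>; m≤m+n; m≤n+m; m+n≤o⇒m≤o∸n; m+n≤o⇒n≤o; +-monoʳ-≤)
  open import Data.Integer using (ℤ; +_; _+_; _*_; -_)
  import Data.Integer.Properties as ℤ
  open import Data.Integer.Tactic.RingSolver using (solve-∀)
  open import Data.Product using (Σ; _×_; _,_)
  open import Relation.Binary.PropositionalEquality
  open import Relation.Nullary using (yes; no)

  Σ<-cong : ∀ n {f g : ℕ → ℤ} → (∀ j → j < n → f j ≡ g j) → Σ< n f ≡ Σ< n g
  Σ<-cong zero p = refl
  Σ<-cong (suc n) p = cong₂ _+_ (Σ<-cong n (λ j lt → p j (≤-trans lt (n≤1+n _)))) (p n ≤-refl)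

  Σ<-head : ∀ n (f : ℕ → ℤ) → Σ< (suc n) f ≡ f 0 + Σ< n (λ j → f (suc j))
  Σ<-head zero f = trans (ℤ.+-identityˡ (f 0)) (sym (ℤ.+-identityʳ (f 0)))
  Σ<-head (suc n) f = trans (cong (_+ f (suc n)) (Σ<-head n f)) (ℤ.+-assoc (f 0) _ _)

  Σ<-neg : ∀ n (f : ℕ → ℤ) → Σ< n (λ j → - f j) ≡ - Σ< n f
  Σ<-neg zero f = refl
  Σ<-neg (suc n) f = trans (cong (_+ (- f n)) (Σ<-neg n f)) (sym (ℤ.neg-distrib-+ (Σ< n f) (f n)))

  Σ<-cut : ∀ m n (f : ℕ → ℤ) → m ≤ n → (∀ j → m ≤ j → f j ≡ + 0) → Σ< n f ≡ Σ< m f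
  Σ<-cut m zero f z≤n f0 = refl
  Σ<-cut m (suc n) f m≤1+n f0 with m ≤? n
  ... | yes m≤n = trans (cong₂ _+_ (Σ<-cut m n f m≤n f0) (f0 n m≤n)) (ℤ.+-identityʳ _)
  ... | no m≰n = cong (λ t → Σ< t f) (≤-antisym (≰⇒> m≰n) m≤1+n)

  ⊛-coeff : ∀ (f g : Series) k → (f ⊛ g) k ≡ Σ< (suc k) (λ i → f i * g (k ∸ i))
  ⊛-coeff f g zero = sym (ℤ.+-identityˡ _)
  ⊛-coeff f g (suc k) = trans (cong (_+_ (f 0 * g (suc k))) (⊛-coeff (tailS f) g k))
    (sym (Σ<-head (suc k) (λ i → f i * g (suc k ∸ i))))

  module _ (W D : Series) (dD : ℕ) (D-vanishes : ∀ k → dD ≤ k → D k ≡ + 0) (D-const : D 0 ≡ + 1) where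

    series-recurrence : ∀ k → (D ⊛ W) k ≡ + 0 → dD ≤ k →
      W k ≡ - Σ< dD (λ j → D (suc j) * W (k ∸ suc j))
    series-recurrence k DW≡0 dD≤k = begin
        W k
      ≡⟨ add-cancel (W k) tail ⟩
        (+ 1 * W k + tail) + - tail
      ≡⟨ cong (λ t → (t * W k + tail) + - tail) (sym D-const) ⟩
        (D 0 * W (k ∸ 0) + tail) + - tail
      ≡⟨ cong (_+ - tail) (sym (trans (⊛-coeff D W k) (Σ<-head k (λ i → D i * W (k ∸ i))))) ⟩
        (D ⊛ W) k + - tail
      ≡⟨ cong (_+ - tail) DW≡0 ⟩
        + 0 + - tail
      ≡⟨ ℤ.+-identityˡ _ ⟩
        - tail
      ≡⟨ cong -_ (Σ<-cut dD k h dD≤k (λ j le → cong (_* W (k ∸ suc j)) (D-vanishes (suc j) (≤-trans le (n≤1+n j))))) ⟩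
        - Σ< dD h
      ∎
      where
      open ≡-Reasoning
      h : ℕ → ℤ
      h j = D (suc j) * W (k ∸ suc j)
      tail : ℤ
      tail = Σ< k h
      add-cancel : ∀ a b → a ≡ (+ 1 * a + b) + - b
      add-cancel = solve-∀

  Recurrence : (ℕ → ℤ) → (ℕ → ℕ) → Set
  Recurrence u start = Σ ℕ λ L → 1 ≤ L × Σ (ℕ → ℤ) λ c →
    ∀ k → start L ≤ k → u k ≡ Σ< L (λ j → c (suc j) * u (k ∸ suc j))

  delay : ∀ B {u} → Recurrence u (λ L → L) → Recurrence u (B +ℕ_)
  delay B (L , 1≤L , c , recurrence) = L , 1≤L , c , λ k B+L≤k → recurrence k (m+n≤o⇒n≤o B B+L≤k)

  rational⇒recurrence : (w W D : Series) (K : ℕ) → (∀ k → K ≤ k → w k ≡ W k) →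
    IsPoly D → D 0 ≡ + 1 → IsPoly (D ⊛ W) → Recurrence w (λ L → L)
  rational⇒recurrence w W D K w≡W (dD , D-vanishes) D-const (dA , DW-vanishes) =
    L , s≤s z≤n , c , recurrence
    where
    L : ℕ
    L = suc (K +ℕ dD +ℕ dA)
    c : ℕ → ℤ
    c j = - D j
    recurrence : ∀ k → L ≤ k → w k ≡ Σ< L (λ j → c (suc j) * w (k ∸ suc j))
    recurrence k L≤k = sym (begin
        Σ< L (λ j → - D (suc j) * w (k ∸ suc j))
      ≡⟨ Σ<-cut dD L _ (≤-trans dD≤K+dD+dA (n≤1+n _))
           (λ j dD≤j → trans (cong (λ t → - t * w (k ∸ suc j)) (D-vanishes (suc j) (≤-trans dD≤j (n≤1+n j))))
                             (ℤ.*-zeroˡ (w (k ∸ suc j)))) ⟩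
        Σ< dD (λ j → - D (suc j) * w (k ∸ suc j))
      ≡⟨ Σ<-cong dD (λ j j<dD → trans (cong (- D (suc j) *_) (w≡W (k ∸ suc j) (K≤k∸ j j<dD)))
                                      (sym (ℤ.neg-distribˡ-* (D (suc j)) _))) ⟩
        Σ< dD (λ j → - (D (suc j) * W (k ∸ suc j)))
      ≡⟨ Σ<-neg dD _ ⟩
        - Σ< dD (λ j → D (suc j) * W (k ∸ suc j))
      ≡⟨ sym (series-recurrence W D dD D-vanishes D-const k (DW-vanishes k dA≤k) dD≤k) ⟩
        W k
      ≡⟨ sym (w≡W k K≤k) ⟩
        w k
      ∎)
      where
      open ≡-Reasoning
      below-L : ∀ {n} → n ≤ K +ℕ dD +ℕ dA → n ≤ k
      below-L n≤ = ≤-trans n≤ (≤-trans (n≤1+n _) L≤k)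
      dD≤K+dD+dA : dD ≤ K +ℕ dD +ℕ dA
      dD≤K+dD+dA = ≤-trans (m≤n+m dD K) (m≤m+n _ dA)
      dD≤k : dD ≤ k
      dD≤k = below-L dD≤K+dD+dA
      dA≤k : dA ≤ k
      dA≤k = below-L (m≤n+m dA _)
      K≤k : K ≤ k
      K≤k = below-L (≤-trans (m≤m+n K dD) (m≤m+n _ dA))
      -- all values of w used by the recurrence lie in the range where w = W
      K≤k∸ : ∀ j → j < dD → K ≤ k ∸ suc j
      K≤k∸ j j<dD = m+n≤o⇒m≤o∸n K (below-L (≤-trans (+-monoʳ-≤ K j<dD) (m≤m+n _ dA)))

module Points where
  open Folds
  open import Data.Bool using (Bool; true; false; _∧_)
  open import Data.Nat using (zero; suc)
  open import Data.Integer using (ℤ; +_; _+_; _*_)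
  import Data.Integer.Properties as ℤ
  open import Data.Vec using (Vec; []; _∷_)
  open import Data.List using (_∷_; [])
  open import Relation.Binary.PropositionalEquality

  _=ᵇ_ : Bool → Bool → Bool
  false =ᵇ false = true
  true =ᵇ true = true
  _ =ᵇ _ = false

  _=ᵛ_ : ∀ {n} → Vec Bool n → Vec Bool n → Bool
  [] =ᵛ [] = true
  (a ∷ as) =ᵛ (b ∷ bs) = (a =ᵇ b) ∧ (as =ᵛ bs)

  Σ-points-concat : ∀ n (f : Vec Bool (suc n) → ℤ) →
    Σℤ (points (suc n)) f ≡ Σℤ (points n) (λ v → f (false ∷ v) + (f (true ∷ v) + + 0))
  Σ-points-concat n f = Sumℤ.⨁-concatMap (λ v → (false ∷ v) ∷ (true ∷ v) ∷ []) (points n) f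

  Σ-points-delta : ∀ n (a : Vec Bool n) (f : Vec Bool n → ℤ) → Σℤ (points n) (λ t → 𝕀 (a =ᵛ t) * f t) ≡ f a
  Σ-points-delta zero [] f = trans (cong (_+ + 0) (ℤ.*-identityˡ (f []))) (ℤ.+-identityʳ _)
  Σ-points-delta (suc n) (b ∷ a) f = begin
      Σℤ (points (suc n)) (λ t → 𝕀 ((b ∷ a) =ᵛ t) * f t)
    ≡⟨ Σ-points-concat n (λ t → 𝕀 ((b ∷ a) =ᵛ t) * f t) ⟩
      Σℤ (points n) (λ v → 𝕀 ((b =ᵇ false) ∧ (a =ᵛ v)) * f (false ∷ v) + (𝕀 ((b =ᵇ true) ∧ (a =ᵛ v)) * f (true ∷ v) + + 0))
    ≡⟨ Sumℤ.⨁-cong (points n) (select b) ⟩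
      Σℤ (points n) (λ v → 𝕀 (a =ᵛ v) * f (b ∷ v))
    ≡⟨ Σ-points-delta n a (λ v → f (b ∷ v)) ⟩
      f (b ∷ a)
    ∎
    where
    open ≡-Reasoning
    -- exactly one of the two extensions of v matches the first bit b
    select : ∀ b v → 𝕀 ((b =ᵇ false) ∧ (a =ᵛ v)) * f (false ∷ v) + (𝕀 ((b =ᵇ true) ∧ (a =ᵛ v)) * f (true ∷ v) + + 0)
                   ≡ 𝕀 (a =ᵛ v) * f (b ∷ v)
    select false v = trans (cong (_+_ (𝕀 (a =ᵛ v) * f (false ∷ v))) (trans (ℤ.+-identityʳ _) (ℤ.*-zeroˡ (f (true ∷ v)))))
                           (ℤ.+-identityʳ _)
    select true v = trans (cong (_+ (𝕀 (a =ᵛ v) * f (true ∷ v) + + 0)) (ℤ.*-zeroˡ (f (false ∷ v))))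
                          (trans (ℤ.+-identityˡ _) (ℤ.+-identityʳ _))

-- Bits of a vector addressed by a natural number (false out of range).
module Bits where
  open import Data.Bool using (Bool; false)
  open import Data.Nat using (ℕ; zero; suc; _<_; _+_; z≤n; s≤s)
  open import Data.Vec using (Vec; []; _∷_; _++_)
  open import Relation.Binary.PropositionalEquality

  bit : ∀ {n} → Vec Bool n → ℕ → Bool
  bit [] i = false
  bit (b ∷ bs) zero = b
  bit (b ∷ bs) (suc i) = bit bs i

  push : ∀ {n} → Bool → Vec Bool n → Vec Bool n
  push b [] = []
  push b (x ∷ xs) = b ∷ push x xs

  bit-push-zero : ∀ {n} b (s : Vec Bool n) → 0 < n → bit (push b s) 0 ≡ b
  bit-push-zero b (x ∷ s) _ = refl

  bit-push-suc : ∀ {n} b (s : Vec Bool n) i → suc i < n → bit (push b s) (suc i) ≡ bit s i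
  bit-push-suc b (x ∷ y ∷ s) zero _ = refl
  bit-push-suc b (x ∷ s) (suc i) (s≤s lt) = bit-push-suc x s i lt

  bit-++ˡ : ∀ {j n} (y : Vec Bool j) (u : Vec Bool n) i → i < j → bit (y ++ u) i ≡ bit y i
  bit-++ˡ (b ∷ y) u zero _ = refl
  bit-++ˡ (b ∷ y) u (suc i) (s≤s lt) = bit-++ˡ y u i lt

  bit-++ʳ : ∀ {j n} (y : Vec Bool j) (u : Vec Bool n) i → bit (y ++ u) (j + i) ≡ bit u i
  bit-++ʳ [] u i = refl
  bit-++ʳ (b ∷ y) u i = bit-++ʳ y u i

  bits-ext : ∀ {n} (a b : Vec Bool n) → (∀ i → i < n → bit a i ≡ bit b i) → a ≡ b
  bits-ext [] [] _ = refl
  bits-ext (x ∷ a) (y ∷ b) p = cong₂ _∷_ (p 0 (s≤s z≤n)) (bits-ext a b (λ i lt → p (suc i) (s≤s lt)))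

-- A reader with memory m: it scans a bit string from its last bit to its
-- first, keeping the window of the m most recently read bits and the parity
-- of the values g(b ∷ window) over the bits b read so far.  Counting strings
-- by start and end state is a linear system over ℤ[[X]]; elimination shows
-- that the number of strings y of length k whose run started from the
-- window of y's own first m bits ends with parity 1 has a rational
-- generating function.
module Automaton (m : ℕ) (g : Vec Bool (suc m) → Bool) where
  open Bits
  open Folds
  open Points
  open PowerSeries
  open Polynomials
  open LinearSystems
  open import Data.Bool using (Bool; true; false; _xor_)
  open import Data.Nat using (ℕ; zero; suc; _≤_; _<_)
  open import Data.Nat.Properties using (≤-trans; <-≤-trans; n≤1+n)
  open import Data.Integer using (ℤ; +_; _+_; _*_)
  import Data.Integer.Properties as ℤ
  open import Data.List using (List; []; _∷_; lookup)
  open import Data.Vec using (Vec; []; _∷_; _++_; replicate)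
  open import Relation.Binary.PropositionalEquality
  open import Algebra.Bundles using (CommutativeRing)
  open BigOp (CommutativeRing.+-commutativeMonoid ring) using (⨁)

  State : Set
  State = Vec Bool (suc m)

  states : List State
  states = points (suc m)

  window : ∀ {j} → Vec Bool j → Vec Bool m → Vec Bool m
  window [] u = u
  window (b ∷ y) u = push b (window y u)

  parityOf : ∀ {j} → Vec Bool j → Vec Bool m → Bool
  parityOf [] u = false
  parityOf (b ∷ y) u = g (b ∷ window y u) xor parityOf y u

  -- the state after reading y from the start state (0, u)
  state : ∀ {j} → Vec Bool j → Vec Bool m → State
  state y u = parityOf y u ∷ window y u

  -- one transition; by definition state (b ∷ y) u = next b (state y u)
  next : Bool → State → State
  next b (p ∷ s) = (g (b ∷ s) xor p) ∷ push b s

  -- transition matrix: the number of bits leading from t to x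
  T : State → State → ℤ
  T x t = Σℤ (false ∷ true ∷ []) (λ b → 𝕀 (next b t =ᵛ x))

  count : Vec Bool m → State → Series
  count u x j = Σℤ (points j) (λ y → 𝕀 (state y u =ᵛ x))

  count-step : ∀ u x j → count u x (suc j) ≡ Σℤ states (λ t → T x t * count u t j)
  count-step u x j = begin
      count u x (suc j)
    ≡⟨ Σ-points-concat j (λ y → 𝕀 (state y u =ᵛ x)) ⟩
      Σℤ (points j) (λ y → T x (state y u))
    ≡⟨ Sumℤ.⨁-cong (points j) (λ y → sym (Σ-points-delta (suc m) (state y u) (T x))) ⟩
      Σℤ (points j) (λ y → Σℤ states (λ t → 𝕀 (state y u =ᵛ t) * T x t))
    ≡⟨ Sumℤ.⨁-swap (points j) states (λ y t → 𝕀 (state y u =ᵛ t) * T x t) ⟩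
      Σℤ states (λ t → Σℤ (points j) (λ y → 𝕀 (state y u =ᵛ t) * T x t))
    ≡⟨ Sumℤ.⨁-cong states (λ t → trans (Sumℤ.⨁-cong (points j) (λ y → ℤ.*-comm (𝕀 (state y u =ᵛ t)) (T x t)))
                                       (sym (⨁-hom ℤ.+-0-commutativeMonoid ℤ.+-0-commutativeMonoid (T x t *_)
                                              (ℤ.*-zeroʳ (T x t)) (ℤ.*-distribˡ-+ (T x t)) (points j) _))) ⟩
      Σℤ states (λ t → T x t * count u t j)
    ∎
    where open ≡-Reasoning

  start : Vec Bool m → State → Series
  start u x = ⟨ 𝕀 ((false ∷ u) =ᵛ x) ⟩

  count-system : ∀ u → System states T (start u) (count u)
  count-system u x = coeffwise coeff-eq
    where
    rest : Series
    rest = ⨁ states (λ t → ⟨ T x t ⟩ ⊛ count u t)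
    rest-coeff : ∀ j → rest j ≡ Σℤ states (λ t → T x t * count u t j)
    rest-coeff j = trans (⨁-coeff states (λ t → ⟨ T x t ⟩ ⊛ count u t) j) (Sumℤ.⨁-cong states (λ t → ⟨⟩-⊛ (T x t) (count u t) j))
    I : ℤ
    I = 𝕀 ((false ∷ u) =ᵛ x)
    coeff-eq : ∀ k → count u x k ≡ (⟨ I ⟩ ⊕ X ⊛ rest) k
    coeff-eq zero = begin
        I + + 0
      ≡⟨ ℤ.+-identityʳ I ⟩
        I
      ≡⟨ sym (ℤ.*-identityʳ I) ⟩
        I * + 1
      ≡⟨ sym (ℤ.+-identityʳ _) ⟩
        I * + 1 + + 0
      ≡⟨ cong (_+_ (I * + 1)) (sym (X-⊛-zero rest)) ⟩
        I * + 1 + (X ⊛ rest) 0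
      ∎
      where open ≡-Reasoning
    coeff-eq (suc j) = sym (begin
        I * + 0 + (X ⊛ rest) (suc j)
      ≡⟨ cong₂ _+_ (ℤ.*-zeroʳ I) (X-⊛ rest j) ⟩
        + 0 + rest j
      ≡⟨ ℤ.+-identityˡ _ ⟩
        rest j
      ≡⟨ rest-coeff j ⟩
        Σℤ states (λ t → T x t * count u t j)
      ≡⟨ sym (count-step u x j) ⟩
        count u x (suc j)
      ∎)
      where open ≡-Reasoning

  window-bits : ∀ {j} (y : Vec Bool j) u i → i < m → bit (window y u) i ≡ bit (y ++ u) i
  window-bits [] u i _ = refl
  window-bits (b ∷ y) u zero lt = bit-push-zero b (window y u) lt
  window-bits (b ∷ y) u (suc i) lt = trans (bit-push-suc b (window y u) i lt) (window-bits y u i (≤-trans (n≤1+n _) lt))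

  -- the window of y itself: its first m bits (padded, if y is short)
  ownWindow : ∀ {j} → Vec Bool j → Vec Bool m
  ownWindow y = window y (replicate m false)

  window-forgets : ∀ {j} → m ≤ j → (y : Vec Bool j) → ∀ u → window y u ≡ ownWindow y
  window-forgets m≤j y u = bits-ext _ _ λ i i<m → begin
      bit (window y u) i                   ≡⟨ window-bits y u i i<m ⟩
      bit (y ++ u) i                       ≡⟨ bit-++ˡ y u i (<-≤-trans i<m m≤j) ⟩
      bit y i                              ≡⟨ sym (bit-++ˡ y _ i (<-≤-trans i<m m≤j)) ⟩
      bit (y ++ replicate m false) i       ≡⟨ sym (window-bits y _ i i<m) ⟩
      bit (ownWindow y) i                  ∎
    where open ≡-Reasoning

  open Elimination (eliminate states T) public using (D; D-poly; D-const)
  open Elimination (eliminate states T) using (P; P-poly; eliminates)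

  closed : Series
  closed = ⨁ (points m) (λ u → count u (true ∷ u))

  D⊛closed-poly : IsPoly (D ⊛ closed)
  D⊛closed-poly = IsPoly-resp (CommutativeRing.sym ring D⊛closed)
                              (IsPoly-⨁ (points m) _ (λ u → D⊛count-poly u (true ∷ u)))
    where
    start-poly : ∀ u x → IsPoly (start u x)
    start-poly u x = IsPoly-⟨⟩ (𝕀 ((false ∷ u) =ᵛ x))
    D⊛count-poly : ∀ u x → IsPoly (D ⊛ count u x)
    D⊛count-poly u x = IsPoly-resp (CommutativeRing.sym ring (eliminates (start u) (count u) (count-system u) x))
      (IsPoly-⊕ (IsPoly-⊛ D-poly (start-poly u x))
                (IsPoly-sum (λ i → P x i ⊛ start u (lookup states i)) (λ i → IsPoly-⊛ (P-poly x i) (start-poly u (lookup states i)))))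
    D⊛closed : D ⊛ closed ≋ ⨁ (points m) (λ u → D ⊛ count u (true ∷ u))
    D⊛closed = ⨁-hom (CommutativeRing.+-commutativeMonoid ring) (CommutativeRing.+-commutativeMonoid ring)
                     (D ⊛_) (CommutativeRing.zeroʳ ring D) (CommutativeRing.distribˡ ring D) (points m) _

  matches-closing : ∀ (p : Bool) (s u : Vec Bool m) → 𝕀 ((p ∷ s) =ᵛ (true ∷ u)) ≡ 𝕀 (s =ᵛ u) * 𝕀 p
  matches-closing false s u = sym (ℤ.*-zeroʳ (𝕀 (s =ᵛ u)))
  matches-closing true s u = sym (ℤ.*-identityʳ (𝕀 (s =ᵛ u)))

  closed-coeff : ∀ k → m ≤ k → closed k ≡ Σℤ (points k) (λ y → 𝕀 (parityOf y (ownWindow y)))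
  closed-coeff k m≤k = begin
      closed k
    ≡⟨ ⨁-coeff (points m) (λ u → count u (true ∷ u)) k ⟩
      Σℤ (points m) (λ u → Σℤ (points k) (λ y → 𝕀 (state y u =ᵛ (true ∷ u))))
    ≡⟨ Sumℤ.⨁-swap (points m) (points k) (λ u y → 𝕀 (state y u =ᵛ (true ∷ u))) ⟩
      Σℤ (points k) (λ y → Σℤ (points m) (λ u → 𝕀 (state y u =ᵛ (true ∷ u))))
    ≡⟨ Sumℤ.⨁-cong (points k) (λ y → Sumℤ.⨁-cong (points m) (λ u →
         trans (matches-closing (parityOf y u) (window y u) u)
               (cong (λ s → 𝕀 (s =ᵛ u) * 𝕀 (parityOf y u)) (window-forgets m≤k y u)))) ⟩
      Σℤ (points k) (λ y → Σℤ (points m) (λ u → 𝕀 (ownWindow y =ᵛ u) * 𝕀 (parityOf y u)))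
    ≡⟨ Sumℤ.⨁-cong (points k) (λ y → Σ-points-delta m (ownWindow y) (λ u → 𝕀 (parityOf y u))) ⟩
      Σℤ (points k) (λ y → 𝕀 (parityOf y (ownWindow y)))
    ∎
    where open ≡-Reasoning

module MonomialEval where
  open Bits
  open Folds
  open import Defs using (monomial; evalMono)
  open import Data.Bool using (Bool; true; false; not; _∧_; _∨_)
  open import Data.Bool.Properties using (∧-commutativeMonoid; ∧-identityʳ; ∨-zeroʳ)
  open import Data.Nat using (ℕ; zero; suc; _<_; _≡ᵇ_; _∸_; _%_; s≤s)
  open import Data.Nat.DivMod using (m%n<n)
  open import Data.Fin using (toℕ)
  open import Data.List using (List; []; _∷_; foldr)
  open import Data.List.Relation.Unary.All using (All; []; _∷_)
  import Data.List.Relation.Unary.All as All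
  open import Data.Vec using (Vec; []; _∷_; tabulate)
  open import Function using (_∘_)
  open import Relation.Binary.PropositionalEquality
  open import Algebra.Bundles using (CommutativeMonoid)
  open import Algebra.Properties.CommutativeSemigroup (CommutativeMonoid.commutativeSemigroup ∧-commutativeMonoid)
    using (interchange)

  allBelow : ℕ → (ℕ → Bool) → Bool
  allBelow zero h = true
  allBelow (suc n) h = h 0 ∧ allBelow n (h ∘ suc)

  allBelow-cong : ∀ n {h h′ : ℕ → Bool} → (∀ i → h i ≡ h′ i) → allBelow n h ≡ allBelow n h′
  allBelow-cong zero p = refl
  allBelow-cong (suc n) p = cong₂ _∧_ (p 0) (allBelow-cong n (p ∘ suc))

  allBelow-true : ∀ n (h : ℕ → Bool) → (∀ i → h i ≡ true) → allBelow n h ≡ true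
  allBelow-true zero h p = refl
  allBelow-true (suc n) h p rewrite p 0 = allBelow-true n (h ∘ suc) (p ∘ suc)

  allBelow-∧ : ∀ n h₁ h₂ → allBelow n (λ i → h₁ i ∧ h₂ i) ≡ allBelow n h₁ ∧ allBelow n h₂
  allBelow-∧ zero h₁ h₂ = refl
  allBelow-∧ (suc n) h₁ h₂ =
    trans (cong (_∧_ (h₁ 0 ∧ h₂ 0)) (allBelow-∧ n (h₁ ∘ suc) (h₂ ∘ suc))) (interchange (h₁ 0) (h₂ 0) _ _)

  allBelow-single : ∀ {n} (x : Vec Bool n) r → r < n → allBelow n (λ i → not (i ≡ᵇ r) ∨ bit x i) ≡ bit x r
  allBelow-single {suc n} (b ∷ x) zero _ =
    trans (cong (b ∧_) (allBelow-true n _ (λ _ → refl))) (∧-identityʳ b)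
  allBelow-single (b ∷ x) (suc r) (s≤s r<n) = allBelow-single x r r<n

  evalMono-tabulate : ∀ {n} (F : ℕ → Bool) (x : Vec Bool n) →
    evalMono (tabulate (λ p → F (toℕ p))) x ≡ allBelow n (λ i → not (F i) ∨ bit x i)
  evalMono-tabulate F [] = refl
  evalMono-tabulate F (b ∷ x) = cong ((not (F 0) ∨ b) ∧_) (evalMono-tabulate (F ∘ suc) x)

  hits : (ℕ → ℕ) → List ℕ → ℕ → Bool
  hits r J i = foldr (λ a b → (i ≡ᵇ r a) ∨ b) false J

  ¬∨⇒ : ∀ c d e → not (c ∨ d) ∨ e ≡ (not c ∨ e) ∧ (not d ∨ e)
  ¬∨⇒ false d e = refl
  ¬∨⇒ true d false = refl
  ¬∨⇒ true d true = sym (∨-zeroʳ (not d))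

  allBelow-hits : ∀ {n} (x : Vec Bool n) (r : ℕ → ℕ) (J : List ℕ) → All (λ a → r a < n) J →
    allBelow n (λ i → not (hits r J i) ∨ bit x i) ≡ every J (λ a → bit x (r a))
  allBelow-hits {n} x r [] [] = allBelow-true n _ (λ _ → refl)
  allBelow-hits {n} x r (a ∷ J) (ra<n ∷ J<n) = begin
      allBelow n (λ i → not ((i ≡ᵇ r a) ∨ hits r J i) ∨ bit x i)
    ≡⟨ allBelow-cong n (λ i → ¬∨⇒ (i ≡ᵇ r a) (hits r J i) (bit x i)) ⟩
      allBelow n (λ i → (not (i ≡ᵇ r a) ∨ bit x i) ∧ (not (hits r J i) ∨ bit x i))
    ≡⟨ allBelow-∧ n _ _ ⟩
      allBelow n (λ i → not (i ≡ᵇ r a) ∨ bit x i) ∧ allBelow n (λ i → not (hits r J i) ∨ bit x i)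
    ≡⟨ cong₂ _∧_ (allBelow-single x (r a) ra<n) (allBelow-hits x r J J<n) ⟩
      bit x (r a) ∧ every J (λ a → bit x (r a))
    ∎
    where open ≡-Reasoning

  eval-monomial : ∀ n (idx : List ℕ) (x : Vec Bool (suc n)) →
    evalMono (monomial (suc n) idx) x ≡ every idx (λ a → bit x ((a ∸ 1) % suc n))
  eval-monomial n idx x = trans (evalMono-tabulate (hits r idx) x)
    (allBelow-hits x r idx (All.universal (λ a → m%n<n (a ∸ 1) (suc n)) idx))
    where
    r : ℕ → ℕ
    r a = (a ∸ 1) % suc n

  bit-tabulate : ∀ {n} (F : ℕ → Bool) i → i < n → bit (tabulate {n = n} (λ p → F (toℕ p))) i ≡ F i
  bit-tabulate F zero (s≤s _) = refl
  bit-tabulate {suc n} F (suc i) (s≤s i<n) = bit-tabulate {n} (F ∘ suc) i i<n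

-- Elementary facts about residues modulo k that make distinct cyclic shifts
-- of a short monomial distinct once k > 2m + 1.
module CyclicArith where
  open import Data.Nat using (ℕ; suc; _≤_; _<_; s≤s; _%_; _+_; _∸_; _<?_)
  open import Data.Nat.Properties
  open import Data.Nat.DivMod using (m<n⇒m%n≡m; m≤n⇒[n∸m]%m≡n%m)
  open import Data.Sum using (_⊎_; inj₁; inj₂)
  open import Data.Empty using (⊥)
  open import Data.Product using (_×_; _,_)
  open import Relation.Binary.PropositionalEquality
  open import Relation.Nullary using (yes; no)
  open import Data.Nat.Tactic.RingSolver using (solve-∀)

  mod-below-double : ∀ x k′ → x < suc k′ + suc k′ →
    (x < suc k′ × x % suc k′ ≡ x) ⊎ (x % suc k′ + suc k′ ≡ x)
  mod-below-double x k′ x<2k with x <? suc k′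
  ... | yes x<k = inj₁ (x<k , m<n⇒m%n≡m x<k)
  ... | no x≮k = inj₂ (trans (cong (_+ suc k′) (sym x∸k≡x%k)) (m∸n+n≡m k≤x))
    where
    k≤x : suc k′ ≤ x
    k≤x = ≮⇒≥ x≮k
    x∸k<k : x ∸ suc k′ < suc k′
    x∸k<k = +-cancelʳ-< (suc k′) (x ∸ suc k′) (suc k′) (subst (_< suc k′ + suc k′) (sym (m∸n+n≡m k≤x)) x<2k)
    x∸k≡x%k : x ∸ suc k′ ≡ x % suc k′
    x∸k≡x%k = trans (sym (m<n⇒m%n≡m x∸k<k)) (m≤n⇒[n∸m]%m≡n%m k≤x)

  no-mutual-shift : ∀ m k′ i j e e′ → e ≤ m → e′ ≤ m → suc (suc (m + m)) ≤ suc k′ → i < j → j < suc k′ →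
    i ≡ (e + j) % suc k′ → j ≡ (e′ + i) % suc k′ → ⊥
  no-mutual-shift m k′ i j e e′ e≤m e′≤m 2m+2≤k i<j j<k i≡ j≡ =
    cases (mod-below-double (e + j) k′ (+-mono-< e<k j<k)) (mod-below-double (e′ + i) k′ (+-mono-< e′<k i<k))
    where
    k : ℕ
    k = suc k′
    m<k : m < k
    m<k = ≤-trans (s≤s (≤-trans (m≤m+n m m) (n≤1+n _))) 2m+2≤k
    e<k : e < k
    e<k = ≤-<-trans e≤m m<k
    e′<k : e′ < k
    e′<k = ≤-<-trans e′≤m m<k
    i<k : i < k
    i<k = <-trans i<j j<k
    cases : (e + j < k × (e + j) % k ≡ e + j) ⊎ ((e + j) % k + k ≡ e + j) →
            (e′ + i < k × (e′ + i) % k ≡ e′ + i) ⊎ ((e′ + i) % k + k ≡ e′ + i) → ⊥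
    -- no wrap-around: i = e + j ≥ j > i
    cases (inj₁ (_ , no-wrap)) _ = <⇒≱ i<j (subst (j ≤_) (sym (trans i≡ no-wrap)) (m≤n+m j e))
    -- both wrap around: j + k = e′ + i < k + i, so j < i
    cases (inj₂ _) (inj₂ wrap′) = <-asym i<j (+-cancelʳ-< k j i (subst (_< i + k) (sym j+k≡e′+i) e′+i<i+k))
      where
      j+k≡e′+i : j + k ≡ e′ + i
      j+k≡e′+i = trans (cong (_+ k) j≡) wrap′
      e′+i<i+k : e′ + i < i + k
      e′+i<i+k = ≤-trans (+-monoˡ-< i e′<k) (≤-reflexive (+-comm k i))
    -- only the first wraps: i + k = e + j = e + e′ + i, so k = e + e′ ≤ 2m
    cases (inj₂ wrap) (inj₁ (_ , no-wrap′)) =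
      1+n≰n (≤-trans (n≤1+n _) (≤-trans 2m+2≤k (≤-trans (≤-reflexive k≡e+e′) (+-mono-≤ e≤m e′≤m))))
      where
      k≡e+e′ : k ≡ e + e′
      k≡e+e′ = +-cancelˡ-≡ i k (e + e′) (begin
          i + k             ≡⟨ cong (_+ k) i≡ ⟩
          (e + j) % k + k   ≡⟨ wrap ⟩
          e + j             ≡⟨ cong (e +_) (trans j≡ no-wrap′) ⟩
          e + (e′ + i)      ≡⟨ rotate e e′ i ⟩
          i + (e + e′)      ∎)
        where
        open ≡-Reasoning
        rotate : ∀ a b c → a + (b + c) ≡ c + (a + b)
        rotate = solve-∀

InRange : ℕ → ℕ → Set
InRange m a = 1 ≤ a × a ≤ suc m

Bounded : ℕ → List (List ℕ) → Set
Bounded m gens = All (λ as → All (InRange m) (1 ∷ as)) gens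

-- f_k is the parity, accumulated by the reader of memory m, of the window
-- function  g(ω) = Σ_i Π_{a ∈ {1, a₂ᵢ, …}} ω(a − 1),  when the reader starts
-- from the window of y itself: each cyclic shift of each generating monomial
-- is then met exactly once, and for k ≥ 2m + 2 these shifts are distinct,
-- so they form the orbit used in the definition of f_k.
module RotationSymmetric (gens : List (List ℕ)) (m : ℕ) (bounded : Bounded m gens) where
  open Bits
  open Folds
  open MonomialEval
  open CyclicArith
  open import Defs using (monomial; shiftIdx; evalMono; orbit; rotSym)
  open import Data.Bool using (Bool; true; false; _xor_; _∨_)
  open import Data.Bool.Properties using (T-≡) renaming (_≟_ to _≟𝔹_)
  open import Data.Nat using (zero; _<_; _+_; _∸_; _%_; _≡ᵇ_; s≤s)
  open import Data.Nat.Properties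
  open import Data.Nat.DivMod using (m<n⇒m%n≡m; [m+n]%n≡m%n)
  open import Data.List using ([]; map; upTo; deduplicate)
  open import Data.List.Properties using (map-upTo; filter-all)
  open import Data.List.Relation.Unary.All using ([]; _∷_)
  import Data.List.Relation.Unary.All as All
  open import Data.List.Relation.Unary.All.Properties using (all-upTo)
  open import Data.List.Relation.Unary.AllPairs using (AllPairs; []; _∷_)
  import Data.List.Relation.Unary.AllPairs.Properties as AllPairs
  open import Data.Vec using (Vec; []; _∷_; _++_; replicate)
  import Data.Vec.Properties as VecP
  open import Data.Product using (Σ; _,_; proj₂)
  open import Function using (_∘_; Equivalence)
  open import Relation.Binary.PropositionalEquality
  open import Relation.Nullary using (¬_; ¬?; Dec; yes; no)

  gen : (ℕ → Bool) → Bool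
  gen ω = parity gens (λ as → every (1 ∷ as) (λ a → ω (a ∸ 1)))

  open Automaton m (λ w → gen (bit w)) public

  gen-local : ∀ (ω ω′ : ℕ → Bool) → (∀ e → e ≤ m → ω e ≡ ω′ e) → gen ω ≡ gen ω′
  gen-local ω ω′ agree = Parity.⨁-congᴬ gens (All.map (λ {as} in-range →
    Every.⨁-congᴬ (1 ∷ as) (All.map (λ {a} a-in-range → agree (a ∸ 1) (∸-monoˡ-≤ 1 (proj₂ a-in-range))) in-range)) bounded)

  parity-upTo-suc : ∀ k (H : ℕ → Bool) → parity (upTo (suc k)) H ≡ H 0 xor parity (upTo k) (H ∘ suc)
  parity-upTo-suc k H = cong (H 0 xor_) (trans (cong (λ l → parity l H) (sym (map-upTo suc k))) (Parity.⨁-map suc (upTo k) H))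

  parity-formula : ∀ {k} (y : Vec Bool k) u → parityOf y u ≡ parity (upTo k) (λ s → gen (λ e → bit (y ++ u) (s + e)))
  parity-formula [] u = refl
  parity-formula {suc k} (b ∷ y) u = begin
      gen (bit (b ∷ window y u)) xor parityOf y u
    ≡⟨ cong₂ _xor_ (gen-local _ _ first-window) (parity-formula y u) ⟩
      gen (λ e → bit ((b ∷ y) ++ u) e) xor parity (upTo k) (λ s → gen (λ e → bit (y ++ u) (s + e)))
    ≡⟨ sym (parity-upTo-suc k (λ s → gen (λ e → bit ((b ∷ y) ++ u) (s + e)))) ⟩
      parity (upTo (suc k)) (λ s → gen (λ e → bit ((b ∷ y) ++ u) (s + e)))
    ∎
    where
    open ≡-Reasoning
    first-window : ∀ e → e ≤ m → bit (b ∷ window y u) e ≡ bit ((b ∷ y) ++ u) e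
    first-window zero _ = refl
    first-window (suc e) e<m = window-bits y u e e<m

  deduplicate-distinct : {A : Set} (dec : (x y : A) → Dec (x ≡ y)) (l : List A) →
    AllPairs (λ x y → ¬ x ≡ y) l → deduplicate dec l ≡ l
  deduplicate-distinct dec [] [] = refl
  deduplicate-distinct dec (x ∷ l) (x∉l ∷ distinct) rewrite deduplicate-distinct dec l distinct =
    cong (x ∷_) (filter-all (¬? ∘ dec x) x∉l)

  module AtLength (k′ : ℕ) (large : suc (suc (m + m)) ≤ suc k′) where
    k : ℕ
    k = suc k′

    m<k : m < k
    m<k = ≤-trans (s≤s (≤-trans (m≤m+n m m) (n≤1+n _))) large

    -- y followed by its own window is the cyclic extension of y
    cyclic : (y : Vec Bool k) → ∀ j → j < k + m → bit (y ++ ownWindow y) j ≡ bit y (j % k)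
    cyclic y j j<k+m with j <? k
    ... | yes j<k = trans (bit-++ˡ y _ j j<k) (cong (bit y) (sym (m<n⇒m%n≡m j<k)))
    ... | no j≮k = begin
        bit (y ++ ownWindow y) j                 ≡⟨ cong (bit (y ++ ownWindow y)) (sym k+r≡j) ⟩
        bit (y ++ ownWindow y) (k + r)           ≡⟨ bit-++ʳ y (ownWindow y) r ⟩
        bit (ownWindow y) r                      ≡⟨ window-bits y _ r r<m ⟩
        bit (y ++ replicate m false) r           ≡⟨ bit-++ˡ y _ r (<-trans r<m m<k) ⟩
        bit y r                                  ≡⟨ cong (bit y) r≡j%k ⟩
        bit y (j % k)                            ∎
      where
      open ≡-Reasoning
      r : ℕ
      r = j ∸ k
      k+r≡j : k + r ≡ j
      k+r≡j = m+[n∸m]≡n (≮⇒≥ j≮k)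
      r<m : r < m
      r<m = +-cancelˡ-< k r m (subst (_< k + m) (sym k+r≡j) j<k+m)
      r≡j%k : r ≡ j % k
      r≡j%k = sym (trans (cong (_% k) (trans (sym k+r≡j) (+-comm k r))) (trans ([m+n]%n≡m%n r k) (m<n⇒m%n≡m (<-trans r<m m<k))))

    -- the variable x_a sits at position (a − 1) mod k
    residue : ℕ → ℕ
    residue a = (a ∸ 1) % k

    shifted : List ℕ → ℕ → Vec Bool k
    shifted idx s = monomial k (shiftIdx s idx)

    shifted-eval : ∀ idx s (y : Vec Bool k) → evalMono (shifted idx s) y ≡ every idx (λ a → bit y (residue (a + s)))
    shifted-eval idx s y = trans (eval-monomial k′ (shiftIdx s idx) y) (Every.⨁-map (_+ s) idx (λ a → bit y (residue a)))

    shifted-self : ∀ as s → s < k → bit (shifted (1 ∷ as) s) s ≡ true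
    shifted-self as s s<k = begin
        bit (shifted (1 ∷ as) s) s
      ≡⟨ bit-tabulate (hits residue (shiftIdx s (1 ∷ as))) s s<k ⟩
        (s ≡ᵇ s % k) ∨ hits residue (shiftIdx s as) s
      ≡⟨ cong (λ t → (s ≡ᵇ t) ∨ hits residue (shiftIdx s as) s) (m<n⇒m%n≡m s<k) ⟩
        (s ≡ᵇ s) ∨ hits residue (shiftIdx s as) s
      ≡⟨ cong (_∨ hits residue (shiftIdx s as) s) (Equivalence.to T-≡ (≡⇒≡ᵇ s s refl)) ⟩
        true
      ∎
      where open ≡-Reasoning

    hits-witness : ∀ idx s i → All (InRange m) idx → hits residue (shiftIdx s idx) i ≡ true →
      Σ ℕ λ a → InRange m a × i ≡ residue (a + s)
    hits-witness (a ∷ idx) s i (a-in ∷ in-range) hit with i ≡ᵇ residue (a + s) in eq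
    ... | true = a , a-in , ≡ᵇ⇒≡ i _ (Equivalence.from T-≡ eq)
    ... | false = hits-witness idx s i in-range hit

    equal-shifts : ∀ as → All (InRange m) (1 ∷ as) → ∀ i j → i < k → shifted (1 ∷ as) i ≡ shifted (1 ∷ as) j →
      Σ ℕ λ e → e ≤ m × i ≡ (e + j) % k
    equal-shifts as in-range i j i<k same
      with hits-witness (1 ∷ as) j i in-range
             (trans (sym (bit-tabulate (hits residue (shiftIdx j (1 ∷ as))) i i<k))
               (trans (cong (λ v → bit v i) (sym same)) (shifted-self as i i<k)))
    ... | a , (1≤a , a≤m+1) , i≡ = a ∸ 1 , ∸-monoˡ-≤ 1 a≤m+1 , trans i≡ (cong (_% k) (+-∸-comm j 1≤a))

    shifts-distinct : ∀ as → All (InRange m) (1 ∷ as) → ∀ {i j} → i < j → j < k → ¬ shifted (1 ∷ as) i ≡ shifted (1 ∷ as) j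
    shifts-distinct as in-range {i} {j} i<j j<k same
      with equal-shifts as in-range i j (<-trans i<j j<k) same | equal-shifts as in-range j i j<k (sym same)
    ... | e , e≤m , i≡ | e′ , e′≤m , j≡
      = no-mutual-shift m k′ i j e e′ e≤m e′≤m large i<j j<k i≡ j≡

    orbit-shifts : ∀ as → All (InRange m) (1 ∷ as) → orbit k (1 ∷ as) ≡ map (shifted (1 ∷ as)) (upTo k)
    orbit-shifts as in-range = deduplicate-distinct (VecP.≡-dec _≟𝔹_) _
      (subst (AllPairs (λ x y → ¬ x ≡ y)) (sym (map-upTo (shifted (1 ∷ as)) k))
        (AllPairs.applyUpTo⁺₁ (shifted (1 ∷ as)) k (shifts-distinct as in-range)))

    bit-shift : (y : Vec Bool k) → ∀ s a → s < k → InRange m a →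
      bit (y ++ ownWindow y) (s + (a ∸ 1)) ≡ bit y (residue (a + s))
    bit-shift y s a s<k (1≤a , a≤m+1) = trans (cyclic y (s + (a ∸ 1)) (+-mono-<-≤ s<k (∸-monoˡ-≤ 1 a≤m+1)))
      (cong (λ t → bit y (t % k)) (trans (+-comm s (a ∸ 1)) (sym (+-∸-comm s 1≤a))))

    -- the reader computes f_k: regroup its parity by generator, then by shift
    parity-rotSym : (y : Vec Bool k) → parityOf y (ownWindow y) ≡ rotSym k gens y
    parity-rotSym y = begin
        parityOf y (ownWindow y)
      ≡⟨ parity-formula y (ownWindow y) ⟩
        parity (upTo k) (λ s → parity gens (λ as → every (1 ∷ as) (λ a → bit (y ++ ownWindow y) (s + (a ∸ 1)))))
      ≡⟨ Parity.⨁-swap (upTo k) gens (λ s as → every (1 ∷ as) (λ a → bit (y ++ ownWindow y) (s + (a ∸ 1)))) ⟩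
        parity gens (λ as → parity (upTo k) (λ s → every (1 ∷ as) (λ a → bit (y ++ ownWindow y) (s + (a ∸ 1)))))
      ≡⟨ Parity.⨁-congᴬ gens (All.map (λ {as} in-range → Parity.⨁-congᴬ (upTo k) (All.map (λ {s} s<k →
           trans (Every.⨁-congᴬ (1 ∷ as) (All.map (bit-shift y s _ s<k) in-range)) (sym (shifted-eval (1 ∷ as) s y)))
           (all-upTo k))) bounded) ⟩
        parity gens (λ as → parity (upTo k) (λ s → evalMono (shifted (1 ∷ as) s) y))
      ≡⟨ Parity.⨁-congᴬ gens (All.map (λ {as} in-range →
           trans (sym (Parity.⨁-map (shifted (1 ∷ as)) (upTo k) (λ mono → evalMono mono y)))
                 (cong (λ l → parity l (λ mono → evalMono mono y)) (sym (orbit-shifts as in-range)))) bounded) ⟩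
        rotSym k gens y
      ∎
      where open ≡-Reasoning

-- A common bound m for all indices: their total sum.
module IndexBound where
  open import Data.Nat using (_+_; _<_; z≤n; s≤s)
  open import Data.Nat.Properties using (≤-trans; m+n≤o⇒m≤o; m+n≤o⇒n≤o; <⇒≤; n≤1+n)
  open import Data.List using ([]; _∷_; foldr)
  open import Data.List.Relation.Unary.All using ([]; _∷_)
  open import Data.Product using (_,_)

  indexSum : List (List ℕ) → ℕ
  indexSum = foldr (λ as acc → foldr _+_ 0 as + acc) 0

  bounded-by : ∀ M as → All (λ a → 1 < a) as → foldr _+_ 0 as ≤ M → All (InRange M) as
  bounded-by M [] [] _ = []
  bounded-by M (a ∷ as) (1<a ∷ 1<as) sum≤M =
    (<⇒≤ 1<a , ≤-trans (m+n≤o⇒m≤o a sum≤M) (n≤1+n M)) ∷ bounded-by M as 1<as (m+n≤o⇒n≤o a sum≤M)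

  bounded : ∀ gens M → indexSum gens ≤ M → All (λ as → All (λ a → 1 < a) as) gens → Bounded M gens
  bounded [] M _ [] = []
  bounded (as ∷ gens) M sum≤M (1<as ∷ 1<gens) =
    ((s≤s z≤n , s≤s z≤n) ∷ bounded-by M as 1<as (m+n≤o⇒m≤o (foldr _+_ 0 as) sum≤M))
    ∷ bounded gens M (m+n≤o⇒n≤o (foldr _+_ 0 as) sum≤M) 1<gens

open import Defs
open import Data.Nat using (ℕ; _+_; _∸_; _≤_; _<_; suc)
open import Data.List using (List; [])
open import Data.List.Relation.Unary.All using (All)
import Data.List.Relation.Unary.All as All
open import Data.List.Relation.Unary.Linked using (Linked)
open import Data.Integer using (ℤ) renaming (_*_ to _*ℤ_)
open import Data.Product using (Σ; _×_; proj₁)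
open import Relation.Binary.PropositionalEquality using (_≡_; _≢_)

-- The weights w_k agree, for k ≥ 2m + 2, with the coefficients of the series
-- `closed` of the reader for the generators, which is rational; hence they
-- satisfy a linear recurrence from some L on.
module WeightRecurrence (gens : List (List ℕ)) (indices>1 : All (λ as → All (λ a → 1 < a) as) gens) where
  open import Data.Nat.Properties using (≤-refl; ≤-trans; m≤m+n; n≤1+n)
  import Data.Nat.Properties as ℕ
  open import Data.Integer using (+_)
  open import Data.Bool using (if_then_else_)
  import Data.Integer.Properties as ℤ
  open import Relation.Binary.PropositionalEquality using (refl; trans; sym; cong)
  open Folds
  open LinearRecurrences

  m : ℕ
  m = IndexBound.indexSum gens

  open RotationSymmetric gens m (IndexBound.bounded gens m ≤-refl indices>1)

  w-as-sum : ∀ k → w gens k ≡ Σℤ (points k) (λ y → 𝕀 (rotSym k gens y))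
  w-as-sum k = ⨁-hom ℕ.+-0-commutativeMonoid ℤ.+-0-commutativeMonoid +_ refl ℤ.pos-+ (points k)
    (λ y → if rotSym k gens y then 1 else 0)

  w≡closed : ∀ k → suc (suc (m + m)) ≤ k → w gens k ≡ closed k
  w≡closed (suc k′) large = trans (w-as-sum (suc k′)) (sym (trans
    (closed-coeff (suc k′) (≤-trans (≤-trans (m≤m+n m m) (n≤1+n _)) (≤-trans (n≤1+n _) large)))
    (Sumℤ.⨁-cong (points (suc k′)) (λ y → cong 𝕀 (AtLength.parity-rotSym k′ large y)))))

  weight-recurrence : Recurrence (w gens) (λ L → L)
  weight-recurrence = rational⇒recurrence (w gens) closed D (suc (suc (m + m))) w≡closed D-poly D-const D⊛closed-poly

-- The recurrence holds from L on, hence from maxDeg + L on.  (Neither the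
-- monotonicity of the indices nor the existence of a generator is needed.)
theorem1 : (gens : List (List ℕ)) → gens ≢ [] →
    All (λ as → All (λ a → 1 < a) as × Linked _<_ as) gens →
    Σ ℕ (λ L → 1 ≤ L × Σ (ℕ → ℤ) (λ c →
      (k : ℕ) → maxDeg gens + L ≤ k →
        w gens k ≡ Σ< L (λ j → c (suc j) *ℤ w gens (k ∸ suc j))))
theorem1 gens _ hyp = LinearRecurrences.delay (maxDeg gens) (WeightRecurrence.weight-recurrence gens (All.map proj₁ hyp))
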